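{- (1) Let $D$ be a digraph and $v\in V(D)$. Then ${\rm adi}(D)-1\le{\rm adi}(D-v)\le{\rm adi}(D)$. (2) Let $G$ be a graph and $v\in V(G)$. Then ${\rm ava}(G)-1\le{\rm ava}(G-v)\le{\rm ava}(G)$.
   Context: Graphs are finite, loopless and may have multiple edges (a bigon counts as a cycle); digraphs are finite, loopless and may have parallel and anti-parallel arcs (a digon counts as a directed cycle). A \emph{complete acyclic coloring} of $D$ is a partition of $V(D)$ into color classes each inducing an acyclic subdigraph such that the union of any two distinct color classes induces a subdigraph containing a directed cycle; ${\rm adi}(D)$ is the maximum number of colors in such a coloring. A \emph{complete arboreal coloring} of $G$ is a partition of $V(G)$ into color classes each inducing a forest such that the union of any two distinct color classes induces a subgraph containing a cycle; ${\rm ava}(G)$ is the maximum number of colors in such a coloring. -}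

module Defs where

open import Data.Nat using (ℕ; zero; suc; _<_; _≤_)
open import Data.Fin using (Fin; zero; suc; inject₁; fromℕ; punchIn)
open import Data.Product using (Σ; ∃; _×_)
open import Data.Sum using (_⊎_)
open import Relation.Binary.PropositionalEquality using (_≡_; _≢_)
open import Relation.Nullary using (¬_)
open import Function.Definitions using (Injective)

-- Digraphs on vertex set Fin n: arc i j = number of arcs from i to j
-- (parallel and anti-parallel arcs allowed), no loops.

record Digraph (n : ℕ) : Set where
  field
    arc      : Fin n → Fin n → ℕ
    loopless : ∀ i → arc i i ≡ 0
open Digraph public

record Graph (n : ℕ) : Set where
  field
    mult     : Fin n → Fin n → ℕ
    loopless : ∀ i → mult i i ≡ 0
    symm     : ∀ i j → mult i j ≡ mult j i
open Graph public

VSet : ℕ → Set₁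
VSet n = Fin n → Set

-- A directed cycle of length k+2 (k+2 ≥ 2) in the
-- subdigraph induced by S: distinct vertices f 0, …, f (k+1), all in S,
-- with an arc f i → f (i+1) and an arc f (k+1) → f 0.  Length 2 = digon.

record DiCycleIn {n : ℕ} (D : Digraph n) (S : VSet n) : Set where
  field
    len    : ℕ
    vtx    : Fin (suc (suc len)) → Fin n
    inj    : Injective _≡_ _≡_ vtx
    inS    : ∀ i → S (vtx i)
    step   : ∀ (i : Fin (suc len)) → 0 < arc D (vtx (inject₁ i)) (vtx (suc i))
    close  : 0 < arc D (vtx (fromℕ (suc len))) (vtx zero)

AcyclicIn : {n : ℕ} → Digraph n → VSet n → Set
AcyclicIn D S = ¬ DiCycleIn D S

-- A cycle through k+2 distinct vertices of S:
-- consecutive vertices (cyclically) are adjacent; a cycle through exactly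
-- two vertices (a bigon) uses two distinct parallel edges, i.e. mult ≥ 2.

EdgeOK : {n : ℕ} → Graph n → ℕ → Fin n → Fin n → Set
EdgeOK G zero     x y = 2 ≤ mult G x y
EdgeOK G (suc _)  x y = 1 ≤ mult G x y

record CycleIn {n : ℕ} (G : Graph n) (S : VSet n) : Set where
  field
    len    : ℕ
    vtx    : Fin (suc (suc len)) → Fin n
    inj    : Injective _≡_ _≡_ vtx
    inS    : ∀ i → S (vtx i)
    step   : ∀ (i : Fin (suc len)) → EdgeOK G len (vtx (inject₁ i)) (vtx (suc i))
    close  : EdgeOK G len (vtx (fromℕ (suc len))) (vtx zero)

ForestIn : {n : ℕ} → Graph n → VSet n → Set
ForestIn G S = ¬ CycleIn G S

ColorClass : {n k : ℕ} → (Fin n → Fin k) → Fin k → VSet n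
ColorClass c a x = c x ≡ a

ClassUnion : {n k : ℕ} → (Fin n → Fin k) → Fin k → Fin k → VSet n
ClassUnion c a b x = c x ≡ a ⊎ c x ≡ b

record CompleteAcyclicColoring {n : ℕ} (D : Digraph n) (k : ℕ) : Set where
  field
    col       : Fin n → Fin k
    surj      : ∀ a → ∃ λ x → col x ≡ a
    acyclic   : ∀ a → AcyclicIn D (ColorClass col a)
    complete  : ∀ a b → a ≢ b → DiCycleIn D (ClassUnion col a b)

record CompleteArborealColoring {n : ℕ} (G : Graph n) (k : ℕ) : Set where
  field
    col       : Fin n → Fin k
    surj      : ∀ a → ∃ λ x → col x ≡ a
    forest    : ∀ a → ForestIn G (ColorClass col a)
    complete  : ∀ a b → a ≢ b → CycleIn G (ClassUnion col a b)

IsAdi : {n : ℕ} → Digraph n → ℕ → Set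
IsAdi D k = CompleteAcyclicColoring D k × (∀ m → CompleteAcyclicColoring D m → m ≤ k)

IsAva : {n : ℕ} → Graph n → ℕ → Set
IsAva G k = CompleteArborealColoring G k × (∀ m → CompleteArborealColoring G m → m ≤ k)

-- Vertex deletion: vertices of D - v are Fin n, embedded by punchIn v.

delV : {n : ℕ} → Digraph (suc n) → Fin (suc n) → Digraph n
delV D v = record
  { arc      = λ i j → arc D (punchIn v i) (punchIn v j)
  ; loopless = λ i → Digraph.loopless D (punchIn v i) }

delVG : {n : ℕ} → Graph (suc n) → Fin (suc n) → Graph n
delVG G v = record
  { mult     = λ i j → mult G (punchIn v i) (punchIn v j)
  ; loopless = λ i → Graph.loopless G (punchIn v i)
  ; symm     = λ i j → Graph.symm G (punchIn v i) (punchIn v j) }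

module Submission where

-- Both parts are instances of one abstract argument.  Fix a monotone
-- predicate Cyclic on vertex sets ("the induced subdigraph / subgraph
-- contains a cycle").  The key fact is the
-- merging lemma: if a coloring with k+1 classes is complete except that
-- the pairs involving one "hub" class are not known to be cyclic, then
-- either all those pairs are cyclic (a complete (k+1)-coloring) or the hub
-- merges with a class it is not linked to (a complete k-coloring); either
-- way the maximum is at least k.
--
-- For a vertex v, adding {v} as a new hub class to a complete coloring of
-- D - v gives adi(D - v) ≤ adi(D).  Restricting a complete (k+1)-coloring
-- of D to D - v keeps every pair of classes avoiding v's color cyclic: if v
-- is not alone in its class this is again a hub situation, otherwise
-- dropping v's color is a complete k-coloring of D - v; so
-- adi(D) ≤ adi(D - v) + 1.  The file develops the abstract argument first
-- and then checks its hypotheses (monotonicity, cycles have two vertices,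
-- cycles lift from and restrict to D - v) for directed and undirected cycles.

open import Defs
open import Data.Nat using (ℕ; suc; _≤_)
open import Data.Fin using (Fin)
open import Data.Product using (_×_)

open import Data.Nat using (_<_; zero; z≤n; s≤s; _≤?_)
open import Data.Nat.Properties using (≤-trans; n≤1+n)
open import Data.Fin using (zero; suc; punchIn; punchOut; _≟_)
open import Data.Fin.Properties
  using (punchIn-injective; punchInᵢ≢i; punchOut-injective; punchIn-punchOut; any?; 0≢1+n; suc-injective)
open import Data.Vec.Functional using (insertAt)
open import Data.Vec.Functional.Properties using (insertAt-lookup; insertAt-punchIn)
open import Data.Product using (∃; _,_; proj₁)
open import Data.Sum using (_⊎_; inj₁; inj₂; [_,_]; swap) renaming (map to ⊎-map)
open import Data.Empty using (⊥-elim)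
open import Function using (_∘_; id)
open import Function.Definitions using (Injective)
open import Relation.Nullary using (¬_; yes; no; contradiction)
open import Relation.Unary using (_⊆_)
open import Relation.Binary.PropositionalEquality
  using (_≡_; _≢_; refl; sym; trans; cong; subst; subst₂)

data PunchView {n : ℕ} (i : Fin (suc n)) : Fin (suc n) → Set where
  here  : PunchView i i
  there : (j : Fin n) → PunchView i (punchIn i j)

punchView : ∀ {n} (i y : Fin (suc n)) → PunchView i y
punchView i y with i ≟ y
... | yes refl = here
... | no i≢y   = subst (PunchView i) (punchIn-punchOut i≢y) (there (punchOut i≢y))

-- Double negation commutes with finite conjunctions; this lets the merging
-- lemma decide "all pairs with the hub are cyclic" without excluded middle.
¬¬-∀-Fin : ∀ k {Q : Fin k → Set} → (∀ t → ¬ ¬ Q t) → ¬ ¬ (∀ t → Q t)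
¬¬-∀-Fin zero    ¬¬Q ¬∀Q = ¬∀Q (λ ())
¬¬-∀-Fin (suc k) ¬¬Q ¬∀Q =
  ¬¬Q zero λ Q₀ → ¬¬-∀-Fin k (¬¬Q ∘ suc) λ Qₛ →
    ¬∀Q λ { zero → Q₀ ; (suc t) → Qₛ t }

module CompleteColorings {N : ℕ} (Cyclic : VSet N → Set)
  (cyclic-mono : ∀ {S T : VSet N} → S ⊆ T → Cyclic S → Cyclic T) where

  record Complete (k : ℕ) : Set where
    field
      col      : Fin N → Fin k
      surj     : ∀ a → ∃ λ x → col x ≡ a
      acyclic  : ∀ a → ¬ Cyclic (ColorClass col a)
      complete : ∀ a b → a ≢ b → Cyclic (ClassUnion col a b)

  Bound : ℕ → Set
  Bound m = ∀ j → Complete j → j ≤ m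

  IsMax : ℕ → Set
  IsMax m = Complete m × Bound m

  -- A coloring with k+1 classes that is complete except possibly for the
  -- pairs of classes involving the class hub.
  record NearComplete (k : ℕ) : Set where
    field
      col      : Fin N → Fin (suc k)
      hub      : Fin (suc k)
      surj     : ∀ a → ∃ λ x → col x ≡ a
      acyclic  : ∀ a → ¬ Cyclic (ColorClass col a)
      complete : ∀ a b → a ≢ b → Cyclic (ClassUnion col (punchIn hub a) (punchIn hub b))

  module _ {k : ℕ} (nc : NearComplete k) where
    open NearComplete nc

    Linked : Fin k → Set
    Linked t = Cyclic (ClassUnion col hub (punchIn hub t))

    allLinked⇒complete : (∀ t → Linked t) → Complete (suc k)
    allLinked⇒complete linked = record
      { col = col ; surj = surj ; acyclic = acyclic ; complete = complete′ }
      where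
      complete′ : ∀ a b → a ≢ b → Cyclic (ClassUnion col a b)
      complete′ a b a≢b with punchView hub a | punchView hub b
      ... | here    | here    = contradiction refl a≢b
      ... | here    | there j = linked j
      ... | there i | here    = cyclic-mono swap (linked i)
      ... | there i | there j = complete i j (a≢b ∘ cong (punchIn hub))

    absorbHub : ∀ t → ¬ Linked t → Complete k
    absorbHub t unlinked = record
      { col = absorb ∘ col ; surj = surj′ ; acyclic = acyclic′ ; complete = complete′ }
      where
      absorb : Fin (suc k) → Fin k
      absorb = insertAt id hub t

      absorb-punchIn : ∀ b → absorb (punchIn hub b) ≡ b
      absorb-punchIn = insertAt-punchIn id hub t

      absorb-preimage : ∀ {y b} → absorb y ≡ b → (y ≡ hub × t ≡ b) ⊎ (y ≡ punchIn hub b)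
      absorb-preimage {y} e with punchView hub y
      ... | here    = inj₁ (refl , trans (sym (insertAt-lookup id hub t)) e)
      ... | there j = inj₂ (cong (punchIn hub) (trans (sym (absorb-punchIn j)) e))

      toMerged : ∀ {x a} → col x ≡ punchIn hub a → absorb (col x) ≡ a
      toMerged {a = a} e = trans (cong absorb e) (absorb-punchIn a)

      surj′ : ∀ b → ∃ λ x → absorb (col x) ≡ b
      surj′ b with surj (punchIn hub b)
      ... | x , e = x , toMerged e

      acyclic′ : ∀ b → ¬ Cyclic (ColorClass (absorb ∘ col) b)
      acyclic′ b cyc with b ≟ t
      ... | yes refl = unlinked (cyclic-mono (⊎-map proj₁ id ∘ absorb-preimage) cyc)
      ... | no b≢t   = acyclic (punchIn hub b)
        (cyclic-mono ([ (λ (_ , t≡b) → contradiction (sym t≡b) b≢t) , id ] ∘ absorb-preimage) cyc)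

      complete′ : ∀ a b → a ≢ b → Cyclic (ClassUnion (absorb ∘ col) a b)
      complete′ a b a≢b = cyclic-mono (⊎-map toMerged toMerged) (complete a b a≢b)

  nearComplete-bound : ∀ {k m} → NearComplete k → Bound m → k ≤ m
  nearComplete-bound {k} {m} nc bound with k ≤? m
  ... | yes k≤m = k≤m
  ... | no  k≰m = ⊥-elim (¬¬-∀-Fin k
        (λ t unlinked → k≰m (bound k (absorbHub nc t unlinked)))
        (λ linked → k≰m (≤-trans (n≤1+n k) (bound (suc k) (allLinked⇒complete nc linked)))))

-- Deleting a vertex v, abstractly: Cyclic lives on Fin (suc n), Cyclic⁻ on
-- the vertices Fin n of the deleted structure (embedded by punchIn v).

module VertexDeletion {n : ℕ} (v : Fin (suc n))
  (Cyclic : VSet (suc n) → Set) (Cyclic⁻ : VSet n → Set)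
  (cyclic-mono  : ∀ {S T : VSet (suc n)} → S ⊆ T → Cyclic S → Cyclic T)
  (cyclic⁻-mono : ∀ {S T : VSet n} → S ⊆ T → Cyclic⁻ S → Cyclic⁻ T)
  -- a cycle has at least two vertices
  (singleton-acyclic : ¬ Cyclic (_≡ v))
  (lift : ∀ S → Cyclic⁻ (S ∘ punchIn v) → Cyclic S)
  (restrict : ∀ S → ¬ S v → Cyclic S → Cyclic⁻ (S ∘ punchIn v)) where

  open CompleteColorings Cyclic cyclic-mono
  module Del = CompleteColorings Cyclic⁻ cyclic⁻-mono

  -- Coloring v with a fresh color 0 turns a complete k-coloring of the
  -- deleted structure into a near-complete one with hub 0.
  addSingletonClass : ∀ {k} → Del.Complete k → NearComplete k
  addSingletonClass {k} c⁻ = record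
    { col = col ; hub = zero ; surj = surj ; acyclic = acyclic ; complete = complete }
    where
    open Del.Complete c⁻ renaming (col to col⁻; surj to surj⁻; acyclic to acyclic⁻; complete to complete⁻)

    col : Fin (suc n) → Fin (suc k)
    col = insertAt (suc ∘ col⁻) v zero

    col-v : col v ≡ zero
    col-v = insertAt-lookup (suc ∘ col⁻) v zero

    col-punchIn : ∀ x → col (punchIn v x) ≡ suc (col⁻ x)
    col-punchIn = insertAt-punchIn (suc ∘ col⁻) v zero

    shift : ∀ {x a} → col⁻ x ≡ a → col (punchIn v x) ≡ suc a
    shift {x} e = trans (col-punchIn x) (cong suc e)

    only-v : ∀ {y} → col y ≡ zero → y ≡ v
    only-v {y} e with punchView v y
    ... | here    = refl
    ... | there x = contradiction (trans (sym e) (col-punchIn x)) 0≢1+n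

    surj : ∀ a → ∃ λ y → col y ≡ a
    surj zero    = v , col-v
    surj (suc a) with surj⁻ a
    ... | x , e = punchIn v x , shift e

    acyclic : ∀ a → ¬ Cyclic (ColorClass col a)
    acyclic zero    cyc = singleton-acyclic (cyclic-mono only-v cyc)
    acyclic (suc a) cyc = acyclic⁻ a (cyclic⁻-mono
      (λ {x} e → suc-injective (trans (sym (col-punchIn x)) e))
      (restrict _ (λ e → 0≢1+n (trans (sym col-v) e)) cyc))

    complete : ∀ a b → a ≢ b → Cyclic (ClassUnion col (suc a) (suc b))
    complete a b a≢b = lift _ (cyclic⁻-mono (⊎-map shift shift) (complete⁻ a b a≢b))

  deletion-lower : ∀ {a a'} → Bound a → Del.Complete a' → a' ≤ a
  deletion-lower bound c⁻ = nearComplete-bound (addSingletonClass c⁻) bound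

  module Restriction {k : ℕ} (c : Complete (suc k)) where
    open Complete c

    col⁻ : Fin n → Fin (suc k)
    col⁻ = col ∘ punchIn v

    acyclic⁻ : ∀ a → ¬ Cyclic⁻ (ColorClass col⁻ a)
    acyclic⁻ a cyc = acyclic a (lift _ cyc)

    complete⁻ : ∀ a b → a ≢ b →
                Cyclic⁻ (ClassUnion col⁻ (punchIn (col v) a) (punchIn (col v) b))
    complete⁻ a b a≢b = restrict _
      [ punchInᵢ≢i (col v) a ∘ sym , punchInᵢ≢i (col v) b ∘ sym ]
      (complete _ _ (a≢b ∘ punchIn-injective (col v) a b))

    shared : ∃ (λ w → col⁻ w ≡ col v) → Del.NearComplete k
    shared (w , w~v) = record
      { col = col⁻ ; hub = col v ; surj = surj⁻ ; acyclic = acyclic⁻ ; complete = complete⁻ }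
      where
      surj⁻ : ∀ a → ∃ λ x → col⁻ x ≡ a
      surj⁻ a with surj a
      ... | y , e with punchView v y
      ... | here    = w , trans w~v e
      ... | there x = x , e

    alone : (∀ x → col⁻ x ≢ col v) → Del.Complete k
    alone apart = record
      { col = col′ ; surj = surj′ ; acyclic = acyclic′ ; complete = complete′ }
      where
      col′ : Fin n → Fin k
      col′ x = punchOut (apart x ∘ sym)

      fromDropped : ∀ {x b} → col′ x ≡ b → col⁻ x ≡ punchIn (col v) b
      fromDropped {x} e = trans (sym (punchIn-punchOut (apart x ∘ sym))) (cong (punchIn (col v)) e)

      toDropped : ∀ {x b} → col⁻ x ≡ punchIn (col v) b → col′ x ≡ b
      toDropped {x} {b} e =
        punchIn-injective (col v) _ b (trans (punchIn-punchOut (apart x ∘ sym)) e)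

      surj′ : ∀ b → ∃ λ x → col′ x ≡ b
      surj′ b with surj (punchIn (col v) b)
      ... | y , e with punchView v y
      ... | here    = contradiction (sym e) (punchInᵢ≢i (col v) b)
      ... | there x = x , toDropped e

      acyclic′ : ∀ b → ¬ Cyclic⁻ (ColorClass col′ b)
      acyclic′ b cyc = acyclic⁻ (punchIn (col v) b) (cyclic⁻-mono fromDropped cyc)

      complete′ : ∀ a b → a ≢ b → Cyclic⁻ (ClassUnion col′ a b)
      complete′ a b a≢b = cyclic⁻-mono (⊎-map toDropped toDropped) (complete⁻ a b a≢b)

    upper : ∀ {a'} → Del.Bound a' → suc k ≤ suc a'
    upper bound⁻ with any? (λ x → col⁻ x ≟ col v)
    ... | yes w~v = s≤s (Del.nearComplete-bound (shared w~v) bound⁻)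
    ... | no none = s≤s (bound⁻ k (alone λ x w~v → none (x , w~v)))

  deletion-upper : ∀ {a a'} → Complete a → Del.Bound a' → a ≤ suc a'
  deletion-upper {zero}  _ _ = z≤n
  deletion-upper {suc k} c bound⁻ = Restriction.upper c bound⁻

  deletion-bounds : ∀ {a a'} → IsMax a → Del.IsMax a' → (a ≤ suc a') × (a' ≤ a)
  deletion-bounds (c , bound) (c⁻ , bound⁻) = deletion-upper c bound⁻ , deletion-lower bound c⁻

module Avoiding {n ℓ : ℕ} (v : Fin (suc n)) (f : Fin ℓ → Fin (suc n))
  (avoids : ∀ i → v ≢ f i) where

  pulled : Fin ℓ → Fin n
  pulled i = punchOut (avoids i)

  punchIn-pulled : ∀ i → punchIn v (pulled i) ≡ f i
  punchIn-pulled i = punchIn-punchOut (avoids i)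

  pulled-injective : Injective _≡_ _≡_ f → Injective _≡_ _≡_ pulled
  pulled-injective inj {i} {j} e = inj (punchOut-injective (avoids i) (avoids j) e)

diCycle-mono : ∀ {m} {E : Digraph m} {S T : VSet m} → S ⊆ T → DiCycleIn E S → DiCycleIn E T
diCycle-mono S⊆T cyc = record
  { len = len ; vtx = vtx ; inj = inj ; inS = S⊆T ∘ inS ; step = step ; close = close }
  where open DiCycleIn cyc

-- A cycle has two distinct vertices, so a single vertex induces no cycle.
diCycle-nontrivial : ∀ {m} {E : Digraph m} (x : Fin m) → ¬ DiCycleIn E (_≡ x)
diCycle-nontrivial x cyc = 0≢1+n (inj (trans (inS zero) (sym (inS (suc zero)))))
  where open DiCycleIn cyc

diCycle-lift : ∀ {n} (D : Digraph (suc n)) (v : Fin (suc n)) (S : VSet (suc n)) →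
               DiCycleIn (delV D v) (S ∘ punchIn v) → DiCycleIn D S
diCycle-lift D v S cyc = record
  { len = len ; vtx = punchIn v ∘ vtx ; inj = inj ∘ punchIn-injective v _ _
  ; inS = inS ; step = step ; close = close }
  where open DiCycleIn cyc

diCycle-restrict : ∀ {n} (D : Digraph (suc n)) (v : Fin (suc n)) (S : VSet (suc n)) →
                   ¬ S v → DiCycleIn D S → DiCycleIn (delV D v) (S ∘ punchIn v)
diCycle-restrict D v S v∉S cyc = record
  { len = len ; vtx = pulled ; inj = pulled-injective inj
  ; inS = λ i → subst S (sym (punchIn-pulled i)) (inS i)
  ; step = λ i → transport (step i) ; close = transport close }
  where
  open DiCycleIn cyc
  open Avoiding v vtx (λ i v≡ → v∉S (subst S (sym v≡) (inS i)))
  transport : ∀ {i j} → 0 < arc D (vtx i) (vtx j) → 0 < arc (delV D v) (pulled i) (pulled j)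
  transport = subst₂ (λ x y → 0 < arc D x y) (sym (punchIn-pulled _)) (sym (punchIn-pulled _))

EdgeOK-delVG : ∀ {n} (G : Graph (suc n)) (v : Fin (suc n)) l x y →
               EdgeOK (delVG G v) l x y ≡ EdgeOK G l (punchIn v x) (punchIn v y)
EdgeOK-delVG G v zero    x y = refl
EdgeOK-delVG G v (suc l) x y = refl

cycle-mono : ∀ {m} {G : Graph m} {S T : VSet m} → S ⊆ T → CycleIn G S → CycleIn G T
cycle-mono S⊆T cyc = record
  { len = len ; vtx = vtx ; inj = inj ; inS = S⊆T ∘ inS ; step = step ; close = close }
  where open CycleIn cyc

cycle-nontrivial : ∀ {m} {G : Graph m} (x : Fin m) → ¬ CycleIn G (_≡ x)
cycle-nontrivial x cyc = 0≢1+n (inj (trans (inS zero) (sym (inS (suc zero)))))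
  where open CycleIn cyc

cycle-lift : ∀ {n} (G : Graph (suc n)) (v : Fin (suc n)) (S : VSet (suc n)) →
             CycleIn (delVG G v) (S ∘ punchIn v) → CycleIn G S
cycle-lift G v S cyc = record
  { len = len ; vtx = punchIn v ∘ vtx ; inj = inj ∘ punchIn-injective v _ _
  ; inS = inS ; step = λ i → transport (step i) ; close = transport close }
  where
  open CycleIn cyc
  transport : ∀ {x y} → EdgeOK (delVG G v) len x y → EdgeOK G len (punchIn v x) (punchIn v y)
  transport {x} {y} = subst id (EdgeOK-delVG G v len x y)

cycle-restrict : ∀ {n} (G : Graph (suc n)) (v : Fin (suc n)) (S : VSet (suc n)) →
                 ¬ S v → CycleIn G S → CycleIn (delVG G v) (S ∘ punchIn v)
cycle-restrict G v S v∉S cyc = record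
  { len = len ; vtx = pulled ; inj = pulled-injective inj
  ; inS = λ i → subst S (sym (punchIn-pulled i)) (inS i)
  ; step = λ i → transport (step i) ; close = transport close }
  where
  open CycleIn cyc
  open Avoiding v vtx (λ i v≡ → v∉S (subst S (sym v≡) (inS i)))
  transport : ∀ {i j} → EdgeOK G len (vtx i) (vtx j) → EdgeOK (delVG G v) len (pulled i) (pulled j)
  transport {i} {j} e = subst id (sym (EdgeOK-delVG G v len (pulled i) (pulled j)))
    (subst₂ (EdgeOK G len) (sym (punchIn-pulled i)) (sym (punchIn-pulled j)) e)

module _ {m : ℕ} (E : Digraph m) where
  open CompleteColorings (DiCycleIn E) diCycle-mono

  isAdi⇒isMax : ∀ {k} → IsAdi E k → IsMax k
  isAdi⇒isMax (c , max) = toComplete c , λ j cⱼ → max j (fromComplete cⱼ)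
    where
    toComplete : ∀ {j} → CompleteAcyclicColoring E j → Complete j
    toComplete c = record { col = col ; surj = surj ; acyclic = acyclic ; complete = complete }
      where open CompleteAcyclicColoring c
    fromComplete : ∀ {j} → Complete j → CompleteAcyclicColoring E j
    fromComplete c = record { col = col ; surj = surj ; acyclic = acyclic ; complete = complete }
      where open Complete c

module _ {m : ℕ} (G : Graph m) where
  open CompleteColorings (CycleIn G) cycle-mono

  isAva⇒isMax : ∀ {k} → IsAva G k → IsMax k
  isAva⇒isMax (c , max) = toComplete c , λ j cⱼ → max j (fromComplete cⱼ)
    where
    toComplete : ∀ {j} → CompleteArborealColoring G j → Complete j
    toComplete c = record { col = col ; surj = surj ; acyclic = forest ; complete = complete }
      where open CompleteArborealColoring c
    fromComplete : ∀ {j} → Complete j → CompleteArborealColoring G j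
    fromComplete c = record { col = col ; surj = surj ; forest = acyclic ; complete = complete }
      where open Complete c

adi-vertex-deletion : ∀ {n : ℕ} (D : Digraph (suc n)) (v : Fin (suc n)) (a a' : ℕ) →
  IsAdi D a → IsAdi (delV D v) a' → (a ≤ suc a') × (a' ≤ a)
adi-vertex-deletion D v a a' adi adi⁻ =
  VertexDeletion.deletion-bounds v (DiCycleIn D) (DiCycleIn (delV D v))
    diCycle-mono diCycle-mono (diCycle-nontrivial v) (diCycle-lift D v) (diCycle-restrict D v)
    (isAdi⇒isMax D adi) (isAdi⇒isMax (delV D v) adi⁻)

ava-vertex-deletion : ∀ {n : ℕ} (G : Graph (suc n)) (v : Fin (suc n)) (a a' : ℕ) →
  IsAva G a → IsAva (delVG G v) a' → (a ≤ suc a') × (a' ≤ a)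
ava-vertex-deletion G v a a' ava ava⁻ =
  VertexDeletion.deletion-bounds v (CycleIn G) (CycleIn (delVG G v))
    cycle-mono cycle-mono (cycle-nontrivial v) (cycle-lift G v) (cycle-restrict G v)
    (isAva⇒isMax G ava) (isAva⇒isMax (delVG G v) ava⁻)

lemma2p10 :
    (∀ {n : ℕ} (D : Digraph (suc n)) (v : Fin (suc n)) (a a' : ℕ) →
       IsAdi D a → IsAdi (delV D v) a' → (a ≤ suc a') × (a' ≤ a))
    ×
    (∀ {n : ℕ} (G : Graph (suc n)) (v : Fin (suc n)) (a a' : ℕ) →
       IsAva G a → IsAva (delVG G v) a' → (a ≤ suc a') × (a' ≤ a))
lemma2p10 = adi-vertex-deletion , ava-vertex-deletion
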